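{- Let $d\ge 2$ be an integer and let $\mathcal{S}$ be a family of subsets of $[d-1]$ with $|\mathcal{S}|=d$ such that $|S_2\setminus S_1|\le 1$ for all $S_1,S_2\in\mathcal{S}$. Then either $\mathcal{S}=\{S\subseteq[d-1]:|S|\ge d-2\}$ or $\mathcal{S}=\{S\subseteq[d-1]:|S|\le 1\}$.
   Context: For a positive integer $n$, $[n]=\{1,\dots,n\}$. -}

module Defs where

open import Data.Nat using (ℕ)
open import Data.Fin using (Fin)
open import Data.Fin.Subset using (Subset)
open import Data.Product using (∃)
open import Relation.Binary.PropositionalEquality using (_≡_)

-- A family of m subsets of [n] is presented as an injective indexing
-- 𝒮 : Fin m → Subset n (so the family has exactly m distinct members).
-- Membership of a subset S in the family:
_∈𝒮_ : {m n : ℕ} → Subset n → (Fin m → Subset n) → Set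
S ∈𝒮 𝒮 = ∃ λ i → 𝒮 i ≡ S

{-# OPTIONS --safe #-}
-- Since ∣ T ─ S ∣ ≤ 1 forbids chains S ⊂ A ⊂ T of members, a fixed member
-- is inclusion-minimal either in the family or in the family of
-- complements, so we may assume that A = 𝒮 a is minimal. The n + 1 sets
-- 𝒮 k ─ A have at most one element each. If they are pairwise distinct
-- they exhaust the n + 1 subsets of [n] with at most one element, so every
-- singleton occurs among them, A = ∅ and every member has at most one
-- element. Otherwise two members S ≠ T have S ─ A = T ─ A ≠ ∅; then every
-- member lies in C = A ∪ S and the sets C ─ 𝒮 k are distinct with at most
-- one element, so the same count gives C = [n] and every complement has at
-- most one element. Counting once more identifies the family.
module Submission where

open import Defs
open import Data.Nat using (ℕ; suc; _≤_; _∸_; s≤s; z≤n)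
open import Data.Nat.Properties
  using (≤-trans; ≤-reflexive; +-comm; +-monoʳ-≤; m≤n+m∸n; m≤n+o⇒m∸n≤o; 1+n≰n)
open import Data.Fin using (Fin; zero; suc; punchOut; _≟_)
open import Data.Fin.Properties using (any?; injective⇒≤; punchOut-injective; suc-injective)
open import Data.Fin.Subset
  using (Subset; _─_; ∣_∣; _∈_; _∉_; _⊆_; _⊂_; _∪_; ∁; ⁅_⁆; ⊥; Empty; inside; outside)
open import Data.Fin.Subset.Properties
open import Data.Bool using () renaming (_≟_ to _≟ᵇ_)
open import Data.Vec using ([]; _∷_; here; there)
open import Data.Vec.Properties using (≡-dec)
open import Data.Product using (∃; ∃₂; _×_; _,_; proj₁; proj₂)
open import Data.Empty using (⊥-elim)
open import Data.Sum using (_⊎_; inj₁; inj₂)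
open import Function using (_∘_)
open import Function.Bundles using (_⇔_; mk⇔)
open import Function.Definitions using (Injective)
import Function.Properties.Equivalence as ⇔
open import Relation.Binary.Definitions using (DecidableEquality)
open import Relation.Binary.PropositionalEquality
  using (_≡_; _≢_; refl; sym; trans; cong; subst)
open import Relation.Nullary using (¬_; yes; no; contradiction)
open import Relation.Nullary.Decidable using (¬?; _×-dec_; decidable-stable)

private
  variable
    m n : ℕ
    x y : Fin n
    p q r : Subset n

AtMostOne : Subset n → Set
AtMostOne p = ∀ {x y} → x ∈ p → y ∈ p → x ≡ y

x∈p⇒1≤∣p∣ : x ∈ p → 1 ≤ ∣ p ∣
x∈p⇒1≤∣p∣ {x = x} x∈p =
  subst (_≤ _) (∣⁅x⁆∣≡1 x) (p⊆q⇒∣p∣≤∣q∣ (λ y∈⁅x⁆ → subst (_∈ _) (sym (x∈⁅y⁆⇒x≡y x y∈⁅x⁆)) x∈p))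

∣p∣≤1⇒AtMostOne : ∣ p ∣ ≤ 1 → AtMostOne p
∣p∣≤1⇒AtMostOne {p = _ ∷ _}      _       here        here        = refl
∣p∣≤1⇒AtMostOne {p = inside ∷ _} (s≤s h) here        (there y∈p) =
  contradiction (≤-trans (x∈p⇒1≤∣p∣ y∈p) h) λ ()
∣p∣≤1⇒AtMostOne {p = inside ∷ _} (s≤s h) (there x∈p) here        =
  contradiction (≤-trans (x∈p⇒1≤∣p∣ x∈p) h) λ ()
∣p∣≤1⇒AtMostOne {p = s ∷ p}      h       (there x∈p) (there y∈p) =
  cong suc (∣p∣≤1⇒AtMostOne (≤-trans (∣p∣≤∣x∷p∣ s p) h) x∈p y∈p)

AtMostOne⇒∣p∣≤1 : ∀ {n} {p : Subset n} → AtMostOne p → ∣ p ∣ ≤ 1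
AtMostOne⇒∣p∣≤1 {p = []}          _       = z≤n
AtMostOne⇒∣p∣≤1 {p = outside ∷ p} p-small =
  AtMostOne⇒∣p∣≤1 (λ x∈p y∈p → suc-injective (p-small (there x∈p) (there y∈p)))
AtMostOne⇒∣p∣≤1 {n = suc n} {p = inside ∷ p} p-small =
  s≤s (≤-reflexive (trans (cong ∣_∣ p≡⊥) (∣⊥∣≡0 n)))
  where
  p≡⊥ : p ≡ ⊥
  p≡⊥ = Empty-unique λ (y , y∈p) → contradiction (p-small here (there y∈p)) λ ()

AtMostOne-⊆ : p ⊆ q → AtMostOne q → AtMostOne p
AtMostOne-⊆ p⊆q q-small x∈p y∈p = q-small (p⊆q x∈p) (p⊆q y∈p)

x∈p─q⇒x∉q : x ∈ p ─ q → x ∉ q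
x∈p─q⇒x∉q {p = inside ∷ _} {q = outside ∷ _} here        ()
x∈p─q⇒x∉q {p = _ ∷ _}      {q = _ ∷ _}       (there x∈) (there x∈q) = x∈p─q⇒x∉q x∈ x∈q

Empty[p─q]⇒p⊆q : Empty (p ─ q) → p ⊆ q
Empty[p─q]⇒p⊆q {q = q} empty {x} x∈p =
  decidable-stable (x ∈? q) λ x∉q → empty (x , x∈p∧x∉q⇒x∈p─q x∈p x∉q)

p⊆q∧p⊄q⇒p≡q : p ⊆ q → ¬ p ⊂ q → p ≡ q
p⊆q∧p⊄q⇒p≡q {p = p} p⊆q p⊄q = ⊆-antisym p⊆q λ {x} x∈q →
  decidable-stable (x ∈? p) λ x∉p → p⊄q (p⊆q , x , x∈q , x∉p)

∁-injective : ∁ p ≡ ∁ q → p ≡ q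
∁-injective ∁p≡∁q = ⊆-antisym (∁p⊆∁q⇒p⊇q (⊆-reflexive (sym ∁p≡∁q))) (∁p⊆∁q⇒p⊇q (⊆-reflexive ∁p≡∁q))

p⊆∁∁p : p ⊆ ∁ (∁ p)
p⊆∁∁p = x∉p⇒x∈∁p ∘ x∈p⇒x∉∁p

∁q─∁p⊆p─q : ∁ q ─ ∁ p ⊆ p ─ q
∁q─∁p⊆p─q {q = q} {p = p} x∈ =
  x∈p∧x∉q⇒x∈p─q (x∉∁p⇒x∈p (x∈p─q⇒x∉q x∈)) (x∈∁p⇒x∉p (p─q⊆p (∁ q) (∁ p) x∈))

─-cancelˡ : p ⊆ r → q ⊆ r → r ─ p ≡ r ─ q → p ≡ q
─-cancelˡ {r = r} p⊆r q⊆r r─p≡r─q =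
  ⊆-antisym (included p⊆r (sym r─p≡r─q)) (included q⊆r r─p≡r─q)
  where
  included : ∀ {p q} → p ⊆ r → r ─ q ≡ r ─ p → p ⊆ q
  included {p} {q} p⊆r r─q≡r─p {x} x∈p = decidable-stable (x ∈? q) λ x∉q →
    x∈p─q⇒x∉q (subst (x ∈_) r─q≡r─p (x∈p∧x∉q⇒x∈p─q (p⊆r x∈p) x∉q)) x∈p

injective⇒surjective : ∀ {f : Fin n → Fin n} → Injective _≡_ _≡_ f → ∀ c → ∃ λ i → f i ≡ c
injective⇒surjective {n = suc n} {f} f-injective c with any? (λ i → f i ≟ c)
... | yes hit  = hit
... | no  miss = contradiction (injective⇒≤ punched-injective) 1+n≰n
  where
  punched : Fin (suc n) → Fin n
  punched i = punchOut {i = c} {j = f i} λ c≡fi → miss (i , sym c≡fi)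

  punched-injective : Injective _≡_ _≡_ punched
  punched-injective = f-injective ∘ punchOut-injective {i = c} _ _

enumAtMostOne : Fin (suc n) → Subset n
enumAtMostOne zero    = ⊥
enumAtMostOne (suc x) = ⁅ x ⁆

enumAtMostOne-surjective : AtMostOne p → ∃ λ c → enumAtMostOne c ≡ p
enumAtMostOne-surjective {p = p} p-small with nonempty? p
... | no  empty      = zero , sym (Empty-unique empty)
... | yes (x , x∈p) = suc x , ⊆-antisym
  (λ y∈⁅x⁆ → subst (_∈ p) (sym (x∈⁅y⁆⇒x≡y x y∈⁅x⁆)) x∈p)
  (λ y∈p → subst (_∈ ⁅ x ⁆) (p-small x∈p y∈p) (x∈⁅x⁆ x))

injective⇒onto-AtMostOne : (f : Fin (suc n) → Subset n) → Injective _≡_ _≡_ f →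
  (∀ i → AtMostOne (f i)) → AtMostOne p → ∃ λ i → f i ≡ p
injective⇒onto-AtMostOne f f-injective f-small p-small =
  let c , enum[c]≡p = enumAtMostOne-surjective p-small
      i , code[i]≡c = injective⇒surjective code-injective c
  in i , trans (sym (decode i)) (trans (cong enumAtMostOne code[i]≡c) enum[c]≡p)
  where
  code : Fin _ → Fin _
  code i = proj₁ (enumAtMostOne-surjective (f-small i))
  decode : ∀ i → enumAtMostOne (code i) ≡ f i
  decode i = proj₂ (enumAtMostOne-surjective (f-small i))
  code-injective : Injective _≡_ _≡_ code
  code-injective {i} {j} code-i≡code-j =
    f-injective (trans (sym (decode i)) (trans (cong enumAtMostOne code-i≡code-j) (decode j)))

injective⇒covers : (f : Fin (suc n) → Subset n) → Injective _≡_ _≡_ f →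
  (∀ i → AtMostOne (f i)) → ∀ x → ∃ λ i → x ∈ f i
injective⇒covers f f-injective f-small x =
  let i , fi≡⁅x⁆ = injective⇒onto-AtMostOne f f-injective f-small (λ {y} {z} y∈ z∈ →
                     trans (x∈⁅y⁆⇒x≡y x y∈) (sym (x∈⁅y⁆⇒x≡y x z∈)))
  in i , subst (x ∈_) (sym fi≡⁅x⁆) (x∈⁅x⁆ x)

injective⊎collision : ∀ {a} {A : Set a} → DecidableEquality A → (f : Fin m → A) →
  Injective _≡_ _≡_ f ⊎ ∃₂ λ i j → i ≢ j × f i ≡ f j
injective⊎collision _≟ᴬ_ f with any? (λ i → any? λ j → ¬? (i ≟ j) ×-dec (f i ≟ᴬ f j))
... | yes (i , j , collision) = inj₂ (i , j , collision)
... | no  none = inj₁ λ {i} {j} fi≡fj → decidable-stable (i ≟ j) λ i≢j → none (i , j , i≢j , fi≡fj)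

_≟ˢ_ : DecidableEquality (Subset n)
_≟ˢ_ = ≡-dec _≟ᵇ_

∈p∧≢⇒∈q : AtMostOne (p ─ q) → y ∈ p ─ q → x ∈ p → x ≢ y → x ∈ q
∈p∧≢⇒∈q {q = q} {x = x} p─q-small y∈ x∈p x≢y =
  decidable-stable (x ∈? q) λ x∉q → x≢y (p─q-small (x∈p∧x∉q⇒x∈p─q x∈p x∉q) y∈)

⊂-chain⇒¬AtMostOne : p ⊂ q → q ⊂ r → ¬ AtMostOne (r ─ p)
⊂-chain⇒¬AtMostOne (p⊆q , x , x∈q , x∉p) (q⊆r , y , y∈r , y∉q) r─p-small =
  y∉q (subst (_∈ _) (r─p-small (x∈p∧x∉q⇒x∈p─q (q⊆r x∈q) x∉p) (x∈p∧x∉q⇒x∈p─q y∈r (y∉q ∘ p⊆q))) x∈q)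

⊆-by-cases : ∀ r → (∀ {x} → x ∈ r → x ∈ p → x ∈ q) → p ─ r ⊆ q → p ⊆ q
⊆-by-cases r inside-r outside-r {x} x∈p with x ∈? r
... | yes x∈r = inside-r x∈r x∈p
... | no  x∉r = outside-r (x∈p∧x∉q⇒x∈p─q x∈p x∉r)

Dichotomy : (Fin m → Subset n) → Set
Dichotomy 𝒮 = (∀ i → AtMostOne (𝒮 i)) ⊎ (∀ i → AtMostOne (∁ (𝒮 i)))

module AtMinimal {n : ℕ}
  (𝒮 : Fin (suc n) → Subset n) (𝒮-injective : Injective _≡_ _≡_ 𝒮)
  (close : ∀ i j → AtMostOne (𝒮 j ─ 𝒮 i))
  (a : Fin (suc n)) (minimal : ∀ i → ¬ 𝒮 i ⊂ 𝒮 a)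
  where

  A : Subset n
  A = 𝒮 a

  ⊆A⇒≡A : ∀ {k} → 𝒮 k ⊆ A → 𝒮 k ≡ A
  ⊆A⇒≡A {k} k⊆A = p⊆q∧p⊄q⇒p≡q k⊆A (minimal k)

  distinct-differences⇒small : Injective _≡_ _≡_ (λ k → 𝒮 k ─ A) → ∀ k → AtMostOne (𝒮 k)
  distinct-differences⇒small distinct k = AtMostOne-⊆ (λ x∈ → x∈p∧x∉q⇒x∈p─q x∈ (x∉A _)) (close a k)
    where
    x∉A : ∀ x → x ∉ A
    x∉A x = let _ , x∈ = injective⇒covers (λ k → 𝒮 k ─ A) distinct (close a) x in x∈p─q⇒x∉q x∈

  module Collision {i j} (i≢j : i ≢ j) (same : 𝒮 i ─ A ≡ 𝒮 j ─ A) where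

    S T C : Subset n
    S = 𝒮 i
    T = 𝒮 j
    C = A ∪ S

    S─A-nonempty : ∃ λ y → y ∈ S ─ A
    S─A-nonempty with nonempty? (S ─ A)
    ... | yes nonempty = nonempty
    ... | no  empty    = contradiction (𝒮-injective (trans (⊆A⇒≡A S⊆A) (sym (⊆A⇒≡A T⊆A)))) i≢j
      where
      S⊆A : S ⊆ A
      S⊆A = Empty[p─q]⇒p⊆q empty
      T⊆A : T ⊆ A
      T⊆A = Empty[p─q]⇒p⊆q (subst Empty same empty)

    s : Fin n
    s = proj₁ S─A-nonempty

    s∈S─A : s ∈ S ─ A
    s∈S─A = proj₂ S─A-nonempty

    -- s ∈ S, T but s ∉ R, and z ∈ R but z ∉ S, T: closeness then makes S and
    -- T agree with R, hence with each other, on A.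
    outside-A∪S⇒S≡T : ∀ {k z} → z ∈ 𝒮 k ─ A → z ∉ S → S ≡ T
    outside-A∪S⇒S≡T {k} {z} z∈R─A z∉S = ⊆-antisym
      (⊆-by-cases A (λ e∈A → from-R (sym same) e∈A ∘ to-R refl e∈A) (p─q⊆p T A ∘ subst (_ ∈_) same))
      (⊆-by-cases A (λ e∈A → from-R refl e∈A ∘ to-R (sym same) e∈A) (p─q⊆p S A ∘ subst (_ ∈_) (sym same)))
      where
      R : Subset n
      R = 𝒮 k

      s∉R : s ∉ R
      s∉R s∈R = z∉S (subst (_∈ S) s≡z (p─q⊆p S A s∈S─A))
        where
        s≡z : s ≡ z
        s≡z = close a k (x∈p∧x∉q⇒x∈p─q s∈R (x∈p─q⇒x∉q s∈S─A)) z∈R─A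

      module _ {l} (l─A≡S─A : 𝒮 l ─ A ≡ S ─ A) {e} (e∈A : e ∈ A) where
        s∈l : s ∈ 𝒮 l
        s∈l = p─q⊆p (𝒮 l) A (subst (s ∈_) (sym l─A≡S─A) s∈S─A)

        z∉l : z ∉ 𝒮 l
        z∉l z∈l = z∉S (p─q⊆p S A (subst (z ∈_) l─A≡S─A (x∈p∧x∉q⇒x∈p─q z∈l (x∈p─q⇒x∉q z∈R─A))))

        to-R : e ∈ 𝒮 l → e ∈ R
        to-R e∈l = ∈p∧≢⇒∈q (close k l) (x∈p∧x∉q⇒x∈p─q s∈l s∉R) e∈l
          λ { refl → x∈p─q⇒x∉q s∈S─A e∈A }

        from-R : e ∈ R → e ∈ 𝒮 l
        from-R e∈R = ∈p∧≢⇒∈q (close l k) (x∈p∧x∉q⇒x∈p─q (p─q⊆p R A z∈R─A) z∉l) e∈R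
          λ { refl → x∈p─q⇒x∉q z∈R─A e∈A }

    new-elements⊆S : ∀ k → 𝒮 k ─ A ⊆ S
    new-elements⊆S k {z} z∈R─A =
      decidable-stable (z ∈? S) λ z∉S → i≢j (𝒮-injective (outside-A∪S⇒S≡T z∈R─A z∉S))

    ⊆C : ∀ k → 𝒮 k ⊆ C
    ⊆C k = ⊆-by-cases A (λ z∈A _ → x∈p∪q⁺ (inj₁ z∈A)) (x∈p∪q⁺ ∘ inj₂ ∘ new-elements⊆S k)

    C─-injective : Injective _≡_ _≡_ (λ k → C ─ 𝒮 k)
    C─-injective = 𝒮-injective ∘ ─-cancelˡ (⊆C _) (⊆C _)

    C─-small : ∀ k → AtMostOne (C ─ 𝒮 k)
    C─-small k c∈ d∈ = both (split c∈) (split d∈)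
      where
      R : Subset n
      R = 𝒮 k

      split : ∀ {x} → x ∈ C ─ R → x ∈ A ─ R ⊎ (x ∈ S ─ A × x ∉ R)
      split {x} x∈ with x ∈? A | x∈p∪q⁻ A S (p─q⊆p C R x∈)
      ... | yes x∈A | _        = inj₁ (x∈p∧x∉q⇒x∈p─q x∈A (x∈p─q⇒x∉q x∈))
      ... | no  x∉A | inj₁ x∈A = contradiction x∈A x∉A
      ... | no  x∉A | inj₂ x∈S = inj₂ (x∈p∧x∉q⇒x∈p─q x∈S x∉A , x∈p─q⇒x∉q x∈)

      R⊆A : ∀ {x} → x ∈ S ─ A → x ∉ R → R ⊆ A
      R⊆A x∈S─A x∉R = ⊆-by-cases A (λ r∈A _ → r∈A) λ r∈R─A →
        let r∈S─A = x∈p∧x∉q⇒x∈p─q (new-elements⊆S k r∈R─A) (x∈p─q⇒x∉q r∈R─A)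
        in contradiction (subst (_∈ R) (close a i r∈S─A x∈S─A) (p─q⊆p R A r∈R─A)) x∉R

      ¬R⊆A : ∀ {x} → x ∈ A ─ R → ¬ R ⊆ A
      ¬R⊆A x∈A─R R⊆A = x∈p─q⇒x∉q x∈A─R (subst (_ ∈_) (sym (⊆A⇒≡A R⊆A)) (p─q⊆p A R x∈A─R))

      both : ∀ {c d} → c ∈ A ─ R ⊎ (c ∈ S ─ A × c ∉ R) → d ∈ A ─ R ⊎ (d ∈ S ─ A × d ∉ R) → c ≡ d
      both (inj₁ c∈A─R)         (inj₁ d∈A─R)         = close k a c∈A─R d∈A─R
      both (inj₂ (c∈S─A , _))   (inj₂ (d∈S─A , _))   = close a i c∈S─A d∈S─A
      both (inj₁ c∈A─R)         (inj₂ (d∈S─A , d∉R)) = ⊥-elim (¬R⊆A c∈A─R (R⊆A d∈S─A d∉R))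
      both (inj₂ (c∈S─A , c∉R)) (inj₁ d∈A─R)         = ⊥-elim (¬R⊆A d∈A─R (R⊆A c∈S─A c∉R))

    C-full : ∀ x → x ∈ C
    C-full x = let l , x∈ = injective⇒covers (λ l → C ─ 𝒮 l) C─-injective C─-small x in p─q⊆p C (𝒮 l) x∈

    complements-small : ∀ k → AtMostOne (∁ (𝒮 k))
    complements-small k = AtMostOne-⊆ (λ {x} x∈∁R → x∈p∧x∉q⇒x∈p─q (C-full x) (x∈∁p⇒x∉p x∈∁R)) (C─-small k)

  dichotomy : Dichotomy 𝒮
  dichotomy with injective⊎collision _≟ˢ_ (λ k → 𝒮 k ─ A)
  ... | inj₁ distinct              = inj₁ (distinct-differences⇒small distinct)
  ... | inj₂ (i , j , i≢j , same) = inj₂ (Collision.complements-small i≢j same)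

∁-close : {𝒮 : Fin m → Subset n} → (∀ i j → AtMostOne (𝒮 j ─ 𝒮 i)) →
  ∀ i j → AtMostOne (∁ (𝒮 j) ─ ∁ (𝒮 i))
∁-close close i j = AtMostOne-⊆ ∁q─∁p⊆p─q (close j i)

below⇒∁-minimal : {𝒮 : Fin m → Subset n} → (∀ i j → AtMostOne (𝒮 j ─ 𝒮 i)) →
  ∀ {a d} → 𝒮 d ⊂ 𝒮 a → ∀ i → ¬ ∁ (𝒮 i) ⊂ ∁ (𝒮 a)
below⇒∁-minimal close {d = d} d⊂a i ∁i⊂∁a = ⊂-chain⇒¬AtMostOne d⊂a (∁p⊂∁q⇒p⊃q ∁i⊂∁a) (close d i)

dichotomy : (𝒮 : Fin (suc n) → Subset n) → Injective _≡_ _≡_ 𝒮 →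
  (∀ i j → AtMostOne (𝒮 j ─ 𝒮 i)) → Dichotomy 𝒮
dichotomy 𝒮 𝒮-injective close with any? (λ i → 𝒮 i ⊂? 𝒮 zero)
... | no  nothing-below =
  AtMinimal.dichotomy 𝒮 𝒮-injective close zero (λ i i⊂0 → nothing-below (i , i⊂0))
... | yes (_ , below)
  with AtMinimal.dichotomy (∁ ∘ 𝒮) (𝒮-injective ∘ ∁-injective) (∁-close close) zero
         (below⇒∁-minimal close below)
...   | inj₁ co-small = inj₂ co-small
...   | inj₂ small    = inj₁ λ i → AtMostOne-⊆ p⊆∁∁p (small i)

m∸n≤o⇒m∸o≤n : ∀ m n o → m ∸ n ≤ o → m ∸ o ≤ n
m∸n≤o⇒m∸o≤n m n o m∸n≤o =
  m≤n+o⇒m∸n≤o m o (subst (m ≤_) (+-comm n o) (≤-trans (m≤n+m∸n m n) (+-monoʳ-≤ n m∸n≤o)))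

∣∁p∣≤1⇔n∸1≤∣p∣ : (p : Subset n) → ∣ ∁ p ∣ ≤ 1 ⇔ n ∸ 1 ≤ ∣ p ∣
∣∁p∣≤1⇔n∸1≤∣p∣ {n} p = mk⇔
  (λ h → m∸n≤o⇒m∸o≤n n ∣ p ∣ 1 (subst (_≤ 1) (∣∁p∣≡n∸∣p∣ p) h))
  (λ h → subst (_≤ 1) (sym (∣∁p∣≡n∸∣p∣ p)) (m∸n≤o⇒m∸o≤n n 1 ∣ p ∣ h))

∈𝒮⇔∁∈∁𝒮 : (𝒮 : Fin m → Subset n) (S : Subset n) → S ∈𝒮 𝒮 ⇔ ∁ S ∈𝒮 (∁ ∘ 𝒮)
∈𝒮⇔∁∈∁𝒮 𝒮 S = mk⇔ (λ (i , 𝒮i≡S) → i , cong ∁ 𝒮i≡S) (λ (i , ∁𝒮i≡∁S) → i , ∁-injective ∁𝒮i≡∁S)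

∈𝒮⇔∣∣≤1 : (𝒮 : Fin (suc n) → Subset n) → Injective _≡_ _≡_ 𝒮 →
  (∀ i → AtMostOne (𝒮 i)) → ∀ S → S ∈𝒮 𝒮 ⇔ ∣ S ∣ ≤ 1
∈𝒮⇔∣∣≤1 𝒮 𝒮-injective small S = mk⇔
  (λ { (i , refl) → AtMostOne⇒∣p∣≤1 (small i) })
  (injective⇒onto-AtMostOne 𝒮 𝒮-injective small ∘ ∣p∣≤1⇒AtMostOne)

lemma2 : (n : ℕ) → 1 ≤ n →
    (𝒮 : Fin (suc n) → Subset n) → Injective _≡_ _≡_ 𝒮 →
    (∀ i j → ∣ 𝒮 j ─ 𝒮 i ∣ ≤ 1) →
    (∀ (S : Subset n) → (S ∈𝒮 𝒮) ⇔ (n ∸ 1 ≤ ∣ S ∣))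
    ⊎ (∀ (S : Subset n) → (S ∈𝒮 𝒮) ⇔ (∣ S ∣ ≤ 1))
lemma2 n _ 𝒮 𝒮-injective close with dichotomy 𝒮 𝒮-injective (λ i j → ∣p∣≤1⇒AtMostOne (close i j))
... | inj₁ small    = inj₂ (∈𝒮⇔∣∣≤1 𝒮 𝒮-injective small)
... | inj₂ co-small = inj₁ λ S →
  ⇔.trans (∈𝒮⇔∁∈∁𝒮 𝒮 S)
    (⇔.trans (∈𝒮⇔∣∣≤1 (∁ ∘ 𝒮) (𝒮-injective ∘ ∁-injective) co-small (∁ S)) (∣∁p∣≤1⇔n∸1≤∣p∣ S))
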